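{- For every $n\ge 1$, all $m_1,\dots,m_n\ge 1$, and functions $g_1,\dots,g_n$ with each $g_i\in\{\mathrm{PARITY}_{m_i},\neg\mathrm{PARITY}_{m_i}\}$ (on disjoint blocks of $m_i$ variables), $$\mathrm{Rank}(\mathrm{AND}_n\circ(g_1,\dots,g_n))\ge \Bigl(\sum_{i=1}^n (m_i-1)\Bigr)+1.$$ In particular, $\mathrm{Rank}(\mathrm{AND}_n\circ\mathrm{PARITY}_m)\ge n(m-1)+1$.
   Context: $\mathrm{PARITY}_m$ is the XOR of $m$ bits. $\mathrm{AND}_n\circ(g_1,\dots,g_n)(a^1,\dots,a^n)=\bigwedge_i g_i(a^i)$ with $a^i\in\{0,1\}^{m_i}$. A decision tree queries single variables at internal nodes and has $0/1$-labelled leaves. The rank of a rooted binary tree: leaves have rank $0$; an internal node with children of ranks $a,b$ has rank $a+1$ if $a=b$, else $\max\{a,b\}$. $\mathrm{Rank}(f)$ is the minimum rank of a decision tree computing $f$. -}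

module Defs where

open import Data.Nat using (ℕ; zero; suc; _+_; _∸_; _≤_; _⊔_)
open import Data.Bool using (Bool; true; false; if_then_else_; _xor_; _∧_; not)
open import Data.Fin using (Fin)
open import Data.Product using (Σ; _,_)
open import Data.Vec.Functional using (foldr)
open import Relation.Binary.PropositionalEquality using (_≡_)

data DTree (V : Set) : Set where
  leaf : Bool → DTree V
  node : V → DTree V → DTree V → DTree V

eval : {V : Set} → DTree V → (V → Bool) → Bool
eval (leaf b)       x = b
eval (node v t₀ t₁) x = if x v then eval t₁ x else eval t₀ x

-- rank of the tree: leaves 0; children ranks a,b give a+1 if a = b, else max a b
rankNode : ℕ → ℕ → ℕ
rankNode zero    zero    = 1
rankNode zero    (suc b) = suc b
rankNode (suc a) zero    = suc a
rankNode (suc a) (suc b) = suc (rankNode a b)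

rank : {V : Set} → DTree V → ℕ
rank (leaf b)       = 0
rank (node v t₀ t₁) = rankNode (rank t₀) (rank t₁)

Computes : {V : Set} → DTree V → ((V → Bool) → Bool) → Set
Computes T f = ∀ x → eval T x ≡ f x

RankAtLeast : {V : Set} → ((V → Bool) → Bool) → ℕ → Set
RankAtLeast {V} f k = (T : DTree V) → Computes T f → k ≤ rank T

parity : (m : ℕ) → (Fin m → Bool) → Bool
parity m a = foldr _xor_ false a

andN : (n : ℕ) → (Fin n → Bool) → Bool
andN n a = foldr _∧_ true a

Vars : (n : ℕ) → (Fin n → ℕ) → Set
Vars n m = Σ (Fin n) (λ i → Fin (m i))

andCompose : (n : ℕ) (m : Fin n → ℕ) → ((i : Fin n) → (Fin (m i) → Bool) → Bool)
           → (Vars n m → Bool) → Bool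
andCompose n m g x = andN n (λ i → g i (λ j → x (i , j)))

sumFin : (n : ℕ) → (Fin n → ℕ) → ℕ
sumFin n f = foldr _+_ 0 f

{-# OPTIONS --safe #-}

-- A Prover–Delayer argument. Call a partial assignment undecided when every
-- completely assigned block satisfies its gᵢ and some block is still open;
-- then AND ∘ (g₁,…,gₙ) is not constant on its extensions, so no leaf lies
-- there. When a free variable of block i is queried, Delayer lets Prover
-- choose if block i has another free variable, and otherwise answers so that
-- gᵢ holds on the completed block, which is possible because flipping one bit
-- flips gᵢ. A node whose two subtrees both lie above undecided positions has
-- rank one more than their common lower bound, so from the empty assignment
-- the rank is at least 1 plus Σ (mᵢ − 1), the number of deferrals.

module Submission where

open import Defs
open import Algebra.Bundles using (CommutativeRing)
import Algebra.Properties.CommutativeMonoid.Sum as CommutativeMonoidSum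
import Algebra.Properties.Monoid.Sum as MonoidSum
open import Axiom.UniquenessOfIdentityProofs using (module Decidable⇒UIP)
open import Data.Bool using (Bool; true; false; not; if_then_else_; _xor_; _∧_)
open import Data.Bool.Properties
  using (not-distribˡ-xor; not-distribʳ-xor; xor-∧-commutativeRing; ∧-commutativeMonoid)
open import Data.Empty using (⊥-elim)
open import Data.Fin using (Fin; zero; suc; punchIn; fromℕ<)
open import Data.Fin.Properties using (punchInᵢ≢i) renaming (_≟_ to _≟ᶠ_)
open import Data.Maybe using (Maybe; just; nothing; fromMaybe)
open import Data.Nat using (ℕ; zero; suc; _+_; _*_; _∸_; _≤_; z≤n; s≤s)
open import Data.Nat.Properties
  using (+-0-commutativeMonoid; +-commutativeSemigroup; ≤-refl; ≤-trans; ≤-reflexive; +-comm; +-suc;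
         +-cancelʳ-≡; +-identityʳ; *-identityʳ; m+n≡0⇒m≡0; m∸n≤m; suc-injective; 0≢1+n)
open import Algebra.Properties.CommutativeSemigroup +-commutativeSemigroup using (xy∙z≈zy∙x)
open import Data.Product using (∃; _×_; _,_; proj₁; proj₂)
open import Data.Product.Properties using (≡-dec; ,-injectiveʳ-UIP)
open import Data.Sum using (_⊎_; inj₁; inj₂)
open import Data.Vec.Functional using (updateAt)
open import Data.Vec.Functional.Properties using (updateAt-updates; updateAt-minimal)
open import Function using (_∘_; const; case_of_)
open import Relation.Binary.Definitions using (DecidableEquality)
open import Relation.Nullary using (Dec; yes; no)
open import Relation.Binary.PropositionalEquality
  using (_≡_; _≢_; _≗_; refl; sym; trans; cong; subst; module ≡-Reasoning)

module ℕ-Sum = CommutativeMonoidSum +-0-commutativeMonoid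
module ∧-Sum = CommutativeMonoidSum ∧-commutativeMonoid
module xor-Sum = MonoidSum (CommutativeRing.+-monoid xor-∧-commutativeRing)

sumFin-≡0 : ∀ {N} (f : Fin N → ℕ) → sumFin N f ≡ 0 → ∀ q → f q ≡ 0
sumFin-≡0 {suc N} f Σf≡0 q = m+n≡0⇒m≡0 (f q) (trans (sym (ℕ-Sum.sum-remove f)) Σf≡0)

sumFin-positive : ∀ {N} (f : Fin N → ℕ) → 1 ≤ sumFin N f → ∃ λ q → 1 ≤ f q
sumFin-positive {suc N} f 1≤Σf with f zero in f₀
... | suc _ = zero , subst (1 ≤_) (sym f₀) (s≤s z≤n)
... | zero with sumFin-positive (f ∘ suc) 1≤Σf
...   | q , 1≤fq = suc q , 1≤fq

sumFin-update : ∀ {N} {f f′ : Fin N → ℕ} p → (∀ q → q ≢ p → f q ≡ f′ q) →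
                sumFin N f + f′ p ≡ sumFin N f′ + f p
sumFin-update {suc N} {f} {f′} p agree = begin
  sumFin _ f + f′ p            ≡⟨ cong (_+ f′ p) (ℕ-Sum.sum-remove f) ⟩
  f p + rest f + f′ p          ≡⟨ cong (λ r → f p + r + f′ p) rest-agree ⟩
  f p + rest f′ + f′ p         ≡⟨ xy∙z≈zy∙x (f p) (rest f′) (f′ p) ⟩
  f′ p + rest f′ + f p         ≡⟨ cong (_+ f p) (ℕ-Sum.sum-remove f′) ⟨
  sumFin _ f′ + f p            ∎
  where
  open ≡-Reasoning
  rest : (Fin (suc N) → ℕ) → ℕ
  rest h = sumFin N (h ∘ punchIn p)
  rest-agree : rest f ≡ rest f′
  rest-agree = ℕ-Sum.sum-cong-≗ (λ q → agree (punchIn p q) (punchInᵢ≢i p q))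

sumFin-const : ∀ N c → sumFin N (const c) ≡ N * c
sumFin-const zero    c = refl
sumFin-const (suc N) c = cong (c +_) (sumFin-const N c)

andN-true : ∀ {n} {a : Fin n → Bool} → (∀ i → a i ≡ true) → andN n a ≡ true
andN-true {n} all-true = trans (∧-Sum.sum-cong-≗ all-true) (∧-Sum.sum-replicate-zero n)

andN-false : ∀ {n} (a : Fin n → Bool) i → a i ≡ false → andN n a ≡ false
andN-false {suc n} a i aᵢ≡false = trans (∧-Sum.sum-remove a) (cong (_∧ andN n (a ∘ punchIn i)) aᵢ≡false)

agree-everywhere : ∀ {m} {A : Set} {a b : Fin m → A} j →
                   b j ≡ a j → (∀ q → q ≢ j → b q ≡ a q) → b ≗ a
agree-everywhere j bj≡aj agree q with q ≟ᶠ j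
... | yes refl = bj≡aj
... | no q≢j   = agree q q≢j

rankNode-≥ˡ : ∀ a b → a ≤ rankNode a b
rankNode-≥ˡ zero    b       = z≤n
rankNode-≥ˡ (suc a) zero    = ≤-refl
rankNode-≥ˡ (suc a) (suc b) = s≤s (rankNode-≥ˡ a b)

rankNode-≥ʳ : ∀ a b → b ≤ rankNode a b
rankNode-≥ʳ a       zero    = z≤n
rankNode-≥ʳ zero    (suc b) = ≤-refl
rankNode-≥ʳ (suc a) (suc b) = s≤s (rankNode-≥ʳ a b)

rankNode-positive : ∀ a b → 1 ≤ rankNode a b
rankNode-positive zero    zero    = s≤s z≤n
rankNode-positive zero    (suc b) = s≤s z≤n
rankNode-positive (suc a) zero    = s≤s z≤n
rankNode-positive (suc a) (suc b) = s≤s z≤n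

rankNode-≥-suc : ∀ {k a b} → k ≤ a → k ≤ b → suc k ≤ rankNode a b
rankNode-≥-suc {zero}  {a}     {b}     _         _         = rankNode-positive a b
rankNode-≥-suc {suc k} {suc a} {suc b} (s≤s k≤a) (s≤s k≤b) = s≤s (rankNode-≥-suc k≤a k≤b)

branch : {V : Set} → Bool → DTree V → DTree V → DTree V
branch false t₀ t₁ = t₀
branch true  t₀ t₁ = t₁

rank-branch : ∀ {V} b (t₀ t₁ : DTree V) → rank (branch b t₀ t₁) ≤ rankNode (rank t₀) (rank t₁)
rank-branch false t₀ t₁ = rankNode-≥ˡ (rank t₀) (rank t₁)
rank-branch true  t₀ t₁ = rankNode-≥ʳ (rank t₀) (rank t₁)

eval-node : ∀ {V} {v : V} t₀ t₁ x → eval (node v t₀ t₁) x ≡ eval (branch (x v) t₀ t₁) x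
eval-node {v = v} t₀ t₁ x with x v
... | true  = refl
... | false = refl

PartialAssignment : Set → Set
PartialAssignment V = V → Maybe Bool

infix 4 _⊨_
_⊨_ : {V : Set} → (V → Bool) → PartialAssignment V → Set
x ⊨ ρ = ∀ v {c} → ρ v ≡ just c → x v ≡ c

fill : {V : Set} → PartialAssignment V → V → Bool
fill ρ v = fromMaybe false (ρ v)

fill-⊨ : {V : Set} (ρ : PartialAssignment V) → fill ρ ⊨ ρ
fill-⊨ ρ v ρv with ρ v
fill-⊨ ρ v refl | just c = refl

ComputesOn : {V : Set} → DTree V → ((V → Bool) → Bool) → PartialAssignment V → Set
ComputesOn T f ρ = ∀ x → x ⊨ ρ → eval T x ≡ f x

NonConstantOn : {V : Set} → ((V → Bool) → Bool) → PartialAssignment V → Set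
NonConstantOn f ρ = ∃ λ x → ∃ λ y → x ⊨ ρ × y ⊨ ρ × f x ≢ f y

module PartialAssignmentsOver {V : Set} (_≟_ : DecidableEquality V) where

  infixl 6 _[_≔_]
  _[_≔_] : {A : Set} → (V → A) → V → A → V → A
  (x [ v ≔ a ]) w with w ≟ v
  ... | yes _ = a
  ... | no  _ = x w

  update-hit : ∀ {A} (x : V → A) v a → (x [ v ≔ a ]) v ≡ a
  update-hit x v a with v ≟ v
  ... | yes _   = refl
  ... | no  v≢v = ⊥-elim (v≢v refl)

  update-miss : ∀ {A} (x : V → A) {v w} a → w ≢ v → (x [ v ≔ a ]) w ≡ x w
  update-miss x {v} {w} a w≢v with w ≟ v
  ... | yes w≡v = ⊥-elim (w≢v w≡v)
  ... | no  _   = refl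

  ⊨-restrict : ∀ {ρ v b x} → ρ v ≡ nothing → x ⊨ ρ [ v ≔ just b ] → x ⊨ ρ
  ⊨-restrict {ρ} {v} {b} ρv≡nothing x⊨ w ρw = x⊨ w (trans (update-miss ρ (just b) w≢v) ρw)
    where
    w≢v : w ≢ v
    w≢v refl = case trans (sym ρw) ρv≡nothing of λ ()

  ⊨-update-free : ∀ {ρ v x} c → ρ v ≡ nothing → x ⊨ ρ → x [ v ≔ c ] ⊨ ρ
  ⊨-update-free {ρ} {v} {x} c ρv≡nothing x⊨ρ w ρw = trans (update-miss x c w≢v) (x⊨ρ w ρw)
    where
    w≢v : w ≢ v
    w≢v refl = case trans (sym ρw) ρv≡nothing of λ ()

  computesOn-branch : ∀ {f ρ ρ′ v b} {t₀ t₁ : DTree V} → ComputesOn (node v t₀ t₁) f ρ →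
                      (∀ {x} → x ⊨ ρ′ → x ⊨ ρ × x v ≡ b) → ComputesOn (branch b t₀ t₁) f ρ′
  computesOn-branch {t₀ = t₀} {t₁} computes restrict x x⊨ρ′ with restrict x⊨ρ′
  ... | x⊨ρ , refl = trans (sym (eval-node t₀ t₁ x)) (computes x x⊨ρ)

  computesOn-query : ∀ {f ρ v} {t₀ t₁ : DTree V} → ρ v ≡ nothing → ComputesOn (node v t₀ t₁) f ρ →
                     ∀ b → ComputesOn (branch b t₀ t₁) f (ρ [ v ≔ just b ])
  computesOn-query {ρ = ρ} {v} ρv≡nothing computes b =
    computesOn-branch computes (λ x⊨ → ⊨-restrict ρv≡nothing x⊨ , x⊨ v (update-hit ρ v (just b)))

  data DelayerMove (Position : PartialAssignment V → Set) (score : PartialAssignment V → ℕ)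
                   (ρ : PartialAssignment V) (v : V) (k : ℕ) : Set where
    defer  : (∀ b → Position (ρ [ v ≔ just b ]) × k ≤ score (ρ [ v ≔ just b ])) →
             DelayerMove Position score ρ v k
    answer : ∀ b → Position (ρ [ v ≔ just b ]) → suc k ≤ score (ρ [ v ≔ just b ]) →
             DelayerMove Position score ρ v k

  module ProverDelayer (f : (V → Bool) → Bool)
    (Position : PartialAssignment V → Set) (score : PartialAssignment V → ℕ)
    (nonconstant : ∀ {ρ} → Position ρ → NonConstantOn f ρ)
    (delay : ∀ {ρ v k} → Position ρ → ρ v ≡ nothing → score ρ ≡ suc k → DelayerMove Position score ρ v k)
    where

    Bound : DTree V → Set
    Bound T = ∀ {ρ} → Position ρ → ComputesOn T f ρ → suc (score ρ) ≤ rank T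

    leaf-bound : ∀ b → Bound (leaf b)
    leaf-bound b position computes with nonconstant position
    ... | x , y , x⊨ρ , y⊨ρ , fx≢fy = ⊥-elim (fx≢fy (trans (sym (computes x x⊨ρ)) (computes y y⊨ρ)))

    node-bound : ∀ v t₀ t₁ → (∀ b → Bound (branch b t₀ t₁)) → Bound (node v t₀ t₁)
    node-bound v t₀ t₁ ih {ρ} position computes with ρ v in ρv
    ... | just b = ≤-trans (ih b position (computesOn-branch computes (λ x⊨ρ → x⊨ρ , x⊨ρ v ρv)))
                           (rank-branch b t₀ t₁)
    ... | nothing with score ρ in scoreρ
    ...   | zero  = rankNode-positive (rank t₀) (rank t₁)
    ...   | suc k with delay position ρv scoreρ
    ...     | defer both = rankNode-≥-suc (after false) (after true)
      where
      after : ∀ b → suc k ≤ rank (branch b t₀ t₁)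
      after b = ≤-trans (s≤s (proj₂ (both b))) (ih b (proj₁ (both b)) (computesOn-query ρv computes b))
    ...     | answer b position′ k<score′ =
      ≤-trans (≤-trans (s≤s k<score′) (ih b position′ (computesOn-query ρv computes b)))
              (rank-branch b t₀ t₁)

    rank-bound : ∀ T → Bound T
    rank-bound (leaf b)       = leaf-bound b
    rank-bound (node v t₀ t₁) = node-bound v t₀ t₁ λ { false → rank-bound t₀ ; true → rank-bound t₁ }

record FullySensitive {m : ℕ} (g : (Fin m → Bool) → Bool) : Set where
  field
    respects-≗ : ∀ {a b} → a ≗ b → g a ≡ g b
    flips      : ∀ a j → g (updateAt a j not) ≡ not (g a)

  flips-at : ∀ {a b} j → b j ≡ not (a j) → (∀ q → q ≢ j → b q ≡ a q) → g b ≡ not (g a)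
  flips-at {a} {b} j bj≡¬aj agree = trans (respects-≗ b≗a′) (flips a j)
    where
    b≗a′ : b ≗ updateAt a j not
    b≗a′ = agree-everywhere j (trans bj≡¬aj (sym (updateAt-updates j a)))
                              (λ q q≢j → trans (agree q q≢j) (sym (updateAt-minimal q j a q≢j)))

  satisfyingValue : (Fin m → Bool) → Fin m → Bool
  satisfyingValue a j = if g a then a j else not (a j)

  satisfyingValue-satisfies : ∀ a j {b} → b j ≡ satisfyingValue a j →
                              (∀ q → q ≢ j → b q ≡ a q) → g b ≡ true
  satisfyingValue-satisfies a j bj agree with g a in ga
  ... | true  = trans (respects-≗ (agree-everywhere j bj agree)) ga
  ... | false = trans (flips-at j bj agree) (cong not ga)

open FullySensitive

parity-flips : ∀ {m} (a : Fin m → Bool) j → parity m (updateAt a j not) ≡ not (parity m a)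
parity-flips a zero    = sym (not-distribˡ-xor (a zero) _)
parity-flips a (suc j) =
  trans (cong (a zero xor_) (parity-flips (a ∘ suc) j)) (sym (not-distribʳ-xor (a zero) _))

parity-fullySensitive : ∀ m → FullySensitive (parity m)
parity-fullySensitive m = record { respects-≗ = xor-Sum.sum-cong-≗ ; flips = parity-flips }

not-fullySensitive : ∀ {m} {g : (Fin m → Bool) → Bool} → FullySensitive g → FullySensitive (not ∘ g)
not-fullySensitive s = record
  { respects-≗ = cong not ∘ respects-≗ s
  ; flips      = λ a j → cong not (flips s a j)
  }

fullySensitive-≗ : ∀ {m} {g h : (Fin m → Bool) → Bool} → g ≗ h → FullySensitive h → FullySensitive g
fullySensitive-≗ g≗h s = record
  { respects-≗ = λ {a} {b} a≗b → trans (g≗h a) (trans (respects-≗ s a≗b) (sym (g≗h b)))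
  ; flips      = λ a j → trans (g≗h _) (trans (flips s a j) (cong not (sym (g≗h a))))
  }

parityOrNot-fullySensitive : ∀ {m} {g : (Fin m → Bool) → Bool} →
  ((a : Fin m → Bool) → g a ≡ parity m a) ⊎ ((a : Fin m → Bool) → g a ≡ not (parity m a)) →
  FullySensitive g
parityOrNot-fullySensitive {m} (inj₁ g≗parity)  = fullySensitive-≗ g≗parity (parity-fullySensitive m)
parityOrNot-fullySensitive {m} (inj₂ g≗¬parity) =
  fullySensitive-≗ g≗¬parity (not-fullySensitive (parity-fullySensitive m))

isFree : Maybe Bool → ℕ
isFree nothing  = 1
isFree (just _) = 0

isFree-positive : ∀ {a} → 1 ≤ isFree a → a ≡ nothing
isFree-positive {nothing} _ = refl

isFree-zero : ∀ {a} → isFree a ≡ 0 → ∃ λ c → a ≡ just c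
isFree-zero {just c} _ = c , refl

module AndOfFullySensitive {n : ℕ} (m : Fin n → ℕ) (g : (i : Fin n) → (Fin (m i) → Bool) → Bool)
  (sensitive : ∀ i → FullySensitive (g i)) where

  V : Set
  V = Vars n m

  _≟_ : DecidableEquality V
  _≟_ = ≡-dec _≟ᶠ_ _≟ᶠ_

  open PartialAssignmentsOver _≟_

  F : (V → Bool) → Bool
  F = andCompose n m g

  block : (V → Bool) → (i : Fin n) → Fin (m i) → Bool
  block x i j = x (i , j)

  other-block : ∀ {i k} {j : Fin (m i)} {q : Fin (m k)} → k ≢ i → (k , q) ≢ (i , j)
  other-block k≢i = k≢i ∘ cong proj₁

  other-index : ∀ {i} {j q : Fin (m i)} → q ≢ j → (i , q) ≢ (i , j)
  other-index {i} q≢j = q≢j ∘ ,-injectiveʳ-UIP {B = λ k → Fin (m k)} (Decidable⇒UIP.≡-irrelevant _≟ᶠ_)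

  freeIn : PartialAssignment V → Fin n → ℕ
  freeIn ρ i = sumFin (m i) (λ j → isFree (ρ (i , j)))

  -- Truncation makes a closed block count like one with a single free variable,
  -- so closing a block does not change the excess.
  excess : PartialAssignment V → ℕ
  excess ρ = sumFin n (λ i → freeIn ρ i ∸ 1)

  free-variable : ∀ {ρ i} → 1 ≤ freeIn ρ i → ∃ λ j → ρ (i , j) ≡ nothing
  free-variable {ρ} {i} 1≤free with sumFin-positive (λ j → isFree (ρ (i , j))) 1≤free
  ... | j , 1≤isFree = j , isFree-positive 1≤isFree

  closed-assigned : ∀ {ρ i} → freeIn ρ i ≡ 0 → ∀ j → ∃ λ c → ρ (i , j) ≡ just c
  closed-assigned {ρ} {i} free≡0 j = isFree-zero (sumFin-≡0 (λ j → isFree (ρ (i , j))) free≡0 j)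

  module _ {ρ : PartialAssignment V} {i : Fin n} {j : Fin (m i)} (a : Maybe Bool) where

    private
      ρ′ : PartialAssignment V
      ρ′ = ρ [ (i , j) ≔ a ]

    freeIn-update-other : ∀ {k} → k ≢ i → freeIn ρ′ k ≡ freeIn ρ k
    freeIn-update-other k≢i =
      ℕ-Sum.sum-cong-≗ (λ q → cong isFree (update-miss ρ a (other-block {j = j} {q} k≢i)))

    freeIn-update : freeIn ρ i + isFree a ≡ freeIn ρ′ i + isFree (ρ (i , j))
    freeIn-update =
      trans (cong (freeIn ρ i +_) (cong isFree (sym (update-hit ρ (i , j) a))))
            (sumFin-update j (λ q q≢j → cong isFree (sym (update-miss ρ a (other-index {i} {j} {q} q≢j)))))

    excess-update : excess ρ + (freeIn ρ′ i ∸ 1) ≡ excess ρ′ + (freeIn ρ i ∸ 1)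
    excess-update = sumFin-update i (λ k k≢i → cong (_∸ 1) (sym (freeIn-update-other k≢i)))

  freeIn-query : ∀ {ρ i j} b → ρ (i , j) ≡ nothing → freeIn ρ i ≡ suc (freeIn (ρ [ (i , j) ≔ just b ]) i)
  freeIn-query {ρ} {i} {j} b ρij≡nothing = begin
    freeIn ρ i                          ≡⟨ +-identityʳ (freeIn ρ i) ⟨
    freeIn ρ i + 0                      ≡⟨ freeIn-update {ρ} {i} {j} (just b) ⟩
    freeIn ρ′ i + isFree (ρ (i , j))    ≡⟨ cong (λ a → freeIn ρ′ i + isFree a) ρij≡nothing ⟩
    freeIn ρ′ i + 1                     ≡⟨ +-comm (freeIn ρ′ i) 1 ⟩
    suc (freeIn ρ′ i)                   ∎
    where
    open ≡-Reasoning
    ρ′ : PartialAssignment V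
    ρ′ = ρ [ (i , j) ≔ just b ]

  record Undecided (ρ : PartialAssignment V) : Set where
    field
      closed-satisfied : ∀ i → freeIn ρ i ≡ 0 → ∀ {x} → x ⊨ ρ → g i (block x i) ≡ true
      open-block       : Fin n
      open-block-free  : 1 ≤ freeIn ρ open-block

  open Undecided

  satisfiable-block : ∀ {ρ} → Undecided ρ → ∀ i →
                      ∃ λ (a : Fin (m i) → Bool) → (∀ j {c} → ρ (i , j) ≡ just c → a j ≡ c) × g i a ≡ true
  satisfiable-block {ρ} U i with freeIn ρ i in free
  ... | zero  = block (fill ρ) i , (λ j → fill-⊨ ρ (i , j)) , closed-satisfied U i free (fill-⊨ ρ)
  ... | suc _ with free-variable {ρ} {i} (subst (1 ≤_) (sym free) (s≤s z≤n))
  ...   | j , ρij≡nothing = a , agrees , satisfyingValue-satisfies (sensitive i) a₀ j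
                                            (updateAt-updates j a₀) (λ q q≢j → updateAt-minimal q j a₀ q≢j)
    where
    a₀ : Fin (m i) → Bool
    a₀ = block (fill ρ) i
    a : Fin (m i) → Bool
    a = updateAt a₀ j (const (satisfyingValue (sensitive i) a₀ j))
    agrees : ∀ q {c} → ρ (i , q) ≡ just c → a q ≡ c
    agrees q ρiq = trans (updateAt-minimal q j a₀ q≢j) (fill-⊨ ρ (i , q) ρiq)
      where
      q≢j : q ≢ j
      q≢j refl = case trans (sym ρiq) ρij≡nothing of λ ()

  nonconstant : ∀ {ρ} → Undecided ρ → NonConstantOn F ρ
  nonconstant {ρ} U = x , y , x⊨ρ , y⊨ρ , Fx≢Fy
    where
    x : V → Bool
    x (i , j) = proj₁ (satisfiable-block U i) j
    x⊨ρ : x ⊨ ρ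
    x⊨ρ (i , j) = proj₁ (proj₂ (satisfiable-block U i)) j
    x-satisfies : ∀ i → g i (block x i) ≡ true
    x-satisfies i = proj₂ (proj₂ (satisfiable-block U i))
    i : Fin n
    i = open-block U
    j : Fin (m i)
    j = proj₁ (free-variable {ρ} {i} (open-block-free U))
    y : V → Bool
    y = x [ (i , j) ≔ not (x (i , j)) ]
    y⊨ρ : y ⊨ ρ
    y⊨ρ = ⊨-update-free {ρ} (not (x (i , j))) (proj₂ (free-variable {ρ} {i} (open-block-free U))) x⊨ρ
    y-falsifies : g i (block y i) ≡ false
    y-falsifies = trans (flips-at (sensitive i) j (update-hit x (i , j) _)
                                  (λ q q≢j → update-miss x _ (other-index q≢j)))
                        (cong not (x-satisfies i))
    Fx≢Fy : F x ≢ F y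
    Fx≢Fy Fx≡Fy = case trans (sym (andN-true x-satisfies)) (trans Fx≡Fy (andN-false _ i y-falsifies)) of λ ()

  module _ {ρ : PartialAssignment V} (U : Undecided ρ) {i : Fin n} {j : Fin (m i)}
           (ρij≡nothing : ρ (i , j) ≡ nothing) where

    answered : Bool → PartialAssignment V
    answered b = ρ [ (i , j) ≔ just b ]

    closed-satisfied-answered : ∀ b {k} → k ≢ i → freeIn (answered b) k ≡ 0 →
                                ∀ {x} → x ⊨ answered b → g k (block x k) ≡ true
    closed-satisfied-answered b k≢i free≡0 x⊨ =
      closed-satisfied U _ (trans (sym (freeIn-update-other (just b) k≢i)) free≡0)
                           (⊨-restrict {ρ} ρij≡nothing x⊨)

    answer-open : ∀ b {c} → freeIn ρ i ≡ suc (suc c) →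
                  Undecided (answered b) × suc (excess (answered b)) ≡ excess ρ
    answer-open b {c} free = undecided , excess-drops
      where
      ρ′ : PartialAssignment V
      ρ′ = answered b
      free′ : freeIn ρ′ i ≡ suc c
      free′ = suc-injective (trans (sym (freeIn-query b ρij≡nothing)) free)
      undecided : Undecided ρ′
      closed-satisfied undecided k free≡0 = closed-satisfied-answered b k≢i free≡0
        where
        k≢i : k ≢ i
        k≢i refl = case trans (sym free′) free≡0 of λ ()
      open-block undecided      = i
      open-block-free undecided = subst (1 ≤_) (sym free′) (s≤s z≤n)
      excess-drops : suc (excess ρ′) ≡ excess ρ
      excess-drops = +-cancelʳ-≡ c _ _ (begin
        suc (excess ρ′) + c               ≡⟨ +-suc (excess ρ′) c ⟨
        excess ρ′ + suc c                 ≡⟨ cong (λ f → excess ρ′ + (f ∸ 1)) free ⟨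
        excess ρ′ + (freeIn ρ i ∸ 1)      ≡⟨ excess-update (just b) ⟨
        excess ρ + (freeIn ρ′ i ∸ 1)      ≡⟨ cong (λ f → excess ρ + (f ∸ 1)) free′ ⟩
        excess ρ + c                      ∎)
        where open ≡-Reasoning

    closingValue : Bool
    closingValue = satisfyingValue (sensitive i) (block (fill ρ) i) j

    closingValue-satisfies : freeIn ρ i ≡ 1 → ∀ {x} → x ⊨ answered closingValue → g i (block x i) ≡ true
    closingValue-satisfies free {x} x⊨ =
      satisfyingValue-satisfies (sensitive i) (block (fill ρ) i) j
        (x⊨ (i , j) (update-hit ρ (i , j) (just closingValue))) agree
      where
      free′ : freeIn (answered closingValue) i ≡ 0
      free′ = suc-injective (trans (sym (freeIn-query closingValue ρij≡nothing)) free)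
      agree : ∀ q → q ≢ j → x (i , q) ≡ fill ρ (i , q)
      agree q q≢j with closed-assigned {answered closingValue} {i} free′ q
      ... | c , ρ′iq = trans (x⊨ (i , q) ρ′iq) (sym (fill-⊨ ρ (i , q) ρiq))
        where
        ρiq : ρ (i , q) ≡ just c
        ρiq = trans (sym (update-miss ρ (just closingValue) (other-index {i} {j} {q} q≢j))) ρ′iq

    another-open-block : freeIn ρ i ≡ 1 → 1 ≤ excess ρ → ∃ λ k → k ≢ i × 1 ≤ freeIn ρ k
    another-open-block free 1≤excess with sumFin-positive (λ k → freeIn ρ k ∸ 1) 1≤excess
    ... | k , 1≤free∸1 = k , k≢i , ≤-trans 1≤free∸1 (m∸n≤m _ 1)
      where
      k≢i : k ≢ i
      k≢i refl = case subst (λ f → 1 ≤ f ∸ 1) free 1≤free∸1 of λ ()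

    answer-closing : freeIn ρ i ≡ 1 → 1 ≤ excess ρ →
                     Undecided (answered closingValue) × excess (answered closingValue) ≡ excess ρ
    answer-closing free 1≤excess = undecided , excess-unchanged
      where
      ρ′ : PartialAssignment V
      ρ′ = answered closingValue
      closed-block : ∀ k → freeIn ρ′ k ≡ 0 → Dec (k ≡ i) → ∀ {x} → x ⊨ ρ′ → g k (block x k) ≡ true
      closed-block k _      (yes refl) = closingValue-satisfies free
      closed-block k free≡0 (no k≢i)   = closed-satisfied-answered closingValue k≢i free≡0
      undecided : Undecided ρ′
      undecided with another-open-block free 1≤excess
      ... | k , k≢i , 1≤free = record
        { closed-satisfied = λ k′ free≡0 → closed-block k′ free≡0 (k′ ≟ᶠ i)
        ; open-block       = k
        ; open-block-free  = subst (1 ≤_) (sym (freeIn-update-other (just closingValue) k≢i)) 1≤free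
        }
      excess-unchanged : excess ρ′ ≡ excess ρ
      excess-unchanged = begin
        excess ρ′                        ≡⟨ +-identityʳ (excess ρ′) ⟨
        excess ρ′ + 0                    ≡⟨ cong (λ f → excess ρ′ + (f ∸ 1)) free ⟨
        excess ρ′ + (freeIn ρ i ∸ 1)     ≡⟨ excess-update (just closingValue) ⟨
        excess ρ + (freeIn ρ′ i ∸ 1)     ≡⟨ cong (λ f → excess ρ + (f ∸ 1)) free′ ⟩
        excess ρ + 0                     ≡⟨ +-identityʳ (excess ρ) ⟩
        excess ρ                         ∎
        where
        open ≡-Reasoning
        free′ : freeIn ρ′ i ≡ 0
        free′ = suc-injective (trans (sym (freeIn-query closingValue ρij≡nothing)) free)

  delay : ∀ {ρ v k} → Undecided ρ → ρ v ≡ nothing → excess ρ ≡ suc k → DelayerMove Undecided excess ρ v k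
  delay {ρ} {i , j} {k} U ρij≡nothing excess≡ = move (freeIn ρ i) refl
    where
    move : ∀ f → freeIn ρ i ≡ f → DelayerMove Undecided excess ρ (i , j) k
    move zero          free = ⊥-elim (0≢1+n (trans (sym free) (freeIn-query {ρ} {i} {j} true ρij≡nothing)))
    move (suc zero)    free with answer-closing U ρij≡nothing free (subst (1 ≤_) (sym excess≡) (s≤s z≤n))
    ... | undecided , unchanged = answer _ undecided (≤-reflexive (trans (sym excess≡) (sym unchanged)))
    move (suc (suc c)) free = defer λ b → case answer-open U ρij≡nothing b free of λ where
      (undecided , drops) → undecided , ≤-reflexive (suc-injective (trans (sym excess≡) (sym drops)))

  empty : PartialAssignment V
  empty _ = nothing

  freeIn-empty : ∀ i → freeIn empty i ≡ m i
  freeIn-empty i = trans (sumFin-const (m i) 1) (*-identityʳ (m i))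

  undecided-empty : 1 ≤ n → (∀ i → 1 ≤ m i) → Undecided empty
  closed-satisfied (undecided-empty _ 1≤m) i free≡0 =
    ⊥-elim (case subst (1 ≤_) (trans (sym (freeIn-empty i)) free≡0) (1≤m i) of λ ())
  open-block (undecided-empty 1≤n _)        = fromℕ< 1≤n
  open-block-free (undecided-empty 1≤n 1≤m) = subst (1 ≤_) (sym (freeIn-empty _)) (1≤m _)

  open ProverDelayer F Undecided excess nonconstant delay using (rank-bound)

  rank-lower-bound : 1 ≤ n → (∀ i → 1 ≤ m i) → RankAtLeast F (sumFin n (λ i → m i ∸ 1) + 1)
  rank-lower-bound 1≤n 1≤m T computes =
    subst (_≤ rank T) excess-empty (rank-bound T (undecided-empty 1≤n 1≤m) (λ x _ → computes x))
    where
    excess-empty : suc (excess empty) ≡ sumFin n (λ i → m i ∸ 1) + 1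
    excess-empty = trans (cong suc (ℕ-Sum.sum-cong-≗ (λ i → cong (_∸ 1) (freeIn-empty i)))) (+-comm 1 _)

open AndOfFullySensitive using (rank-lower-bound)

lemma4p7 : ((n : ℕ) → 1 ≤ n → (m : Fin n → ℕ) → ((i : Fin n) → 1 ≤ m i)
               → (g : (i : Fin n) → (Fin (m i) → Bool) → Bool)
               → ((i : Fin n) → ((a : Fin (m i) → Bool) → g i a ≡ parity (m i) a)
                                ⊎ ((a : Fin (m i) → Bool) → g i a ≡ not (parity (m i) a)))
               → RankAtLeast (andCompose n m g) (sumFin n (λ i → m i ∸ 1) + 1))
             × ((n : ℕ) → 1 ≤ n → (m : ℕ) → 1 ≤ m
               → RankAtLeast (andCompose n (λ _ → m) (λ _ → parity m)) (n * (m ∸ 1) + 1))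
lemma4p7 =
    (λ n 1≤n m 1≤m g g-parity →
       rank-lower-bound m g (λ i → parityOrNot-fullySensitive (g-parity i)) 1≤n 1≤m)
  , (λ n 1≤n m 1≤m T computes →
       subst (λ s → s + 1 ≤ rank T) (sumFin-const n (m ∸ 1))
         (rank-lower-bound (const m) (const (parity m)) (const (parity-fullySensitive m)) 1≤n (const 1≤m)
                           T computes))
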